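{- Let $n$ be a positive even integer and $d>0$. For $S\subseteq[n]$ with $|S|=n/2$, let $G_S$ be the weighted complete bipartite graph on $[n]$ with an edge of weight $2d/n$ between every vertex of $S$ and every vertex of $[n]\setminus S$ (and no other edges). Let $S,T\subseteq[n]$ with $|S|=|T|=n/2$, $S\neq T$, and $\frac n8<|S\cap T|<\frac{3n}8$. Then for every $R\subseteq[n]$, if $\Phi_{G_S}(R)>\frac{7nd}{16}$ then $\Phi_{G_T}(R)\le\frac{6nd}{16}$.
   Context: For a weighted graph $G$ on $[n]$ and $R\subseteq[n]$, $\Phi_G(R)$ denotes the total weight of the edges of $G$ with exactly one endpoint in $R$.
   Formalization: The parameter d ranges over the positive rationals. -}

module Defs where

open import Data.Nat as ℕ using (ℕ; zero; suc; NonZero)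
open import Data.Integer using (+_)
open import Data.Rational using (ℚ; 0ℚ; _+_; _*_; _/_)
open import Data.Fin using (Fin; zero; suc)
open import Data.Fin.Subset using (Subset; _∈_; _∉_)
open import Data.Fin.Subset.Properties using (_∈?_)
open import Data.Bool using (Bool; true; false; if_then_else_; _xor_)
open import Data.Vec using (lookup)
open import Relation.Nullary using (yes; no)

sumFin : {n : ℕ} → (Fin n → ℚ) → ℚ
sumFin {zero}  f = 0ℚ
sumFin {suc n} f = f zero + sumFin (λ i → f (suc i))

-- A weighted (undirected) graph on [n] = Fin n: a symmetric weight function,
-- w i j = weight of the edge {i,j} (0 if absent).
WGraph : ℕ → Set
WGraph n = Fin n → Fin n → ℚ

-- Φ_G(R): total weight of edges with exactly one endpoint in R.
-- Each such edge {i,j} is counted exactly once, oriented as (i ∈ R, j ∉ R).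
Φ : {n : ℕ} → WGraph n → Subset n → ℚ
Φ {n} w R = sumFin λ i → sumFin λ j →
  if lookup R i then (if lookup R j then 0ℚ else w i j) else 0ℚ

G : (n : ℕ) → .{{_ : NonZero n}} → (d : ℚ) → Subset n → WGraph n
G n d S i j = if (lookup S i xor lookup S j) then (+ 2 / n) * d else 0ℚ

{-# OPTIONS --safe #-}
-- The atoms A = S ∩ T, B = S ∖ T, C = T ∖ S, E = [n] ∖ (S ∪ T) have sizes k, m, m, k with
-- k + m = h = n/2, and Φ_{G_S}(R) = (2d/n)·cut_S(R), where cut_S(R) counts the pairs i ∈ R, j ∉ R
-- separated by S.  Since S and its complement both have h elements, cut_S(R) + same_S(R) = h²,
-- where same_S(R) counts the pairs of S × ([n] ∖ S) on one side of R; likewise for T.  Summing the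
-- triangle inequality |X||Y||Z| ≤ same(X,Y)|Z| + same(Y,Z)|X| + same(X,Z)|Y| over the atom
-- triples ABC, EBC, AEB, AEC gives same_S(R) + same_T(R) ≥ 2km, and n/8 < k < 3n/8 gives
-- 16km > 3h².  Hence cut_S(R) + cut_T(R) < 13h²/8, so cut_S(R) > 7h²/8 forces cut_T(R) < 3h²/4.
module Submission where

module Counting where

  open import Data.Nat
  open import Data.Nat.Properties
  open import Data.Nat.Tactic.RingSolver using (solve-∀)
  open import Data.Bool.Base using (Bool; true; false; _∧_)
  open import Data.Fin.Base using (Fin)
  open import Data.Vec.Base using ([]; _∷_; lookup)
  open import Data.Fin.Subset using (Subset; ∣_∣; _∩_; ∁)
  open import Data.Fin.Subset.Properties using (∩-comm; ∣∁p∣≡n∸∣p∣)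
  open import Data.Vec.Properties using (lookup-zipWith)
  open import Algebra.Properties.Semiring.Sum +-*-semiring
    using (sum; sum-syntax; ∑-distrib-+; *-distribˡ-sum; *-distribʳ-sum; sum-cong-≗)
  open import Relation.Binary.PropositionalEquality

  -- A Split records how many elements of a set lie inside and outside the cut set R;
  -- cross P Q and same P Q count the pairs of P × Q separated, resp. not separated, by R.
  record Split : Set where
    constructor mkSplit
    field
      inR outR : ℕ

  open Split

  size : Split → ℕ
  size P = inR P + outR P

  _⊕_ : Split → Split → Split
  P ⊕ Q = mkSplit (inR P + inR Q) (outR P + outR Q)

  cross : Split → Split → ℕ
  cross P Q = inR P * outR Q + inR Q * outR P

  same : Split → Split → ℕ
  same P Q = inR P * inR Q + outR P * outR Q

  size-⊕ : ∀ P Q → size (P ⊕ Q) ≡ size P + size Q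
  size-⊕ (mkSplit x x′) (mkSplit y y′) = identity x x′ y y′
    where
    identity : ∀ x x′ y y′ → x + y + (x′ + y′) ≡ x + x′ + (y + y′)
    identity = solve-∀

  cross+same≡size*size : ∀ P Q → cross P Q + same P Q ≡ size P * size Q
  cross+same≡size*size (mkSplit x x′) (mkSplit y y′) = identity x x′ y y′
    where
    identity : ∀ x x′ y y′ → x * y′ + y * x′ + (x * y + x′ * y′) ≡ (x + x′) * (y + y′)
    identity = solve-∀

  -- Among the three pairs of a triple, either one or all three lie on the same side of R.
  same-triangle : ∀ P Q U →
    size P * size Q * size U ≤ same P Q * size U + same Q U * size P + same P U * size Q
  same-triangle (mkSplit x x′) (mkSplit y y′) (mkSplit z z′) = begin
    (x + x′) * (y + y′) * (z + z′)
      ≤⟨ m≤m+n _ _ ⟩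
    (x + x′) * (y + y′) * (z + z′) + 2 * (x * y * z + x′ * y′ * z′)
      ≡⟨ identity x x′ y y′ z z′ ⟩
    (x * y + x′ * y′) * (z + z′) + (y * z + y′ * z′) * (x + x′) + (x * z + x′ * z′) * (y + y′) ∎
    where
    open ≤-Reasoning
    identity : ∀ x x′ y y′ z z′ →
      (x + x′) * (y + y′) * (z + z′) + 2 * (x * y * z + x′ * y′ * z′)
        ≡ (x * y + x′ * y′) * (z + z′) + (y * z + y′ * z′) * (x + x′) + (x * z + x′ * z′) * (y + y′)
    identity = solve-∀

  same-⊕-expand : ∀ A B C E → same (A ⊕ B) (C ⊕ E) + same (A ⊕ C) (B ⊕ E)
    ≡ same A B + same A C + same E B + same E C + 2 * same B C + 2 * same A E
  same-⊕-expand (mkSplit a a′) (mkSplit b b′) (mkSplit c c′) (mkSplit e e′) =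
    identity a a′ b b′ c c′ e e′
    where
    identity : ∀ a a′ b b′ c c′ e e′ →
      (a + b) * (c + e) + (a′ + b′) * (c′ + e′) + ((a + c) * (b + e) + (a′ + c′) * (b′ + e′))
        ≡ a * b + a′ * b′ + (a * c + a′ * c′) + (e * b + e′ * b′) + (e * c + e′ * c′)
          + 2 * (b * c + b′ * c′) + 2 * (a * e + a′ * e′)
    identity = solve-∀

  same-bound : ∀ {k m} A B C E → size A ≡ k → size B ≡ m → size C ≡ m → size E ≡ k →
    2 * (k * m) ≤ same (A ⊕ B) (C ⊕ E) + same (A ⊕ C) (B ⊕ E)
  same-bound {zero} _ _ _ _ _ _ _ _ = z≤n
  same-bound {k@(suc _)} {m} A B C E eA eB eC eE = *-cancelʳ-≤ _ _ (k + m) (begin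
    2 * (k * m) * (k + m)
      ≡⟨ identity₁ k m ⟩
    k * m * m + k * m * m + (k * k * m + k * k * m)
      ≤⟨ +-mono-≤ (+-mono-≤ (△ A B C eA eB eC) (△ E B C eE eB eC))
                  (+-mono-≤ (△ A E B eA eE eB) (△ A E C eA eE eC)) ⟩
    _ ≤⟨ m≤m+n _ _ ⟩
    _ ≡⟨ identity₂ k m (same A B) (same A C) (same E B) (same E C) (same B C) (same A E) ⟩
    (same A B + same A C + same E B + same E C + 2 * same B C + 2 * same A E) * (k + m)
      ≡⟨ cong (_* (k + m)) (same-⊕-expand A B C E) ⟨
    (same (A ⊕ B) (C ⊕ E) + same (A ⊕ C) (B ⊕ E)) * (k + m) ∎)
    where
    open ≤-Reasoning
    △ : ∀ P Q U {p q u} → size P ≡ p → size Q ≡ q → size U ≡ u →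
        p * q * u ≤ same P Q * u + same Q U * p + same P U * q
    △ P Q U refl refl refl = same-triangle P Q U
    identity₁ : ∀ k m → 2 * (k * m) * (k + m) ≡ k * m * m + k * m * m + (k * k * m + k * k * m)
    identity₁ = solve-∀
    identity₂ : ∀ k m p q r s t u →
      p * m + t * k + q * m + (r * m + t * k + s * m) + (u * m + r * k + p * k + (u * m + s * k + q * k))
        + (2 * m * t + 2 * k * u)
        ≡ (p + q + r + s + 2 * t + 2 * u) * (k + m)
    identity₂ = solve-∀

  -- 16km − 3h² = (4k − h)(4m − h), as (4k − h) + (4m − h) = 2h.
  3h²<16km : ∀ {k m} → let h = k + m in h < 4 * k → h < 4 * m → 3 * (h * h) < 16 * (k * m)
  3h²<16km {k} {m} h<4k h<4m = begin-strict
    3 * (h * h)                   <⟨ m<m+n _ (*-mono-< (m<n⇒0<n∸m h<4k) (m<n⇒0<n∸m h<4m)) ⟩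
    3 * (h * h) + x * y           ≡⟨ identity₁ h (x * y) ⟩
    h * h + h * (h + h) + x * y   ≡⟨ cong (λ t → h * h + h * t + x * y) x+y≡h+h ⟨
    h * h + h * (x + y) + x * y   ≡⟨ identity₂ h x y ⟩
    (h + x) * (h + y)             ≡⟨ cong₂ _*_ (m+[n∸m]≡n (<⇒≤ h<4k)) (m+[n∸m]≡n (<⇒≤ h<4m)) ⟩
    4 * k * (4 * m)               ≡⟨ identity₃ k m ⟩
    16 * (k * m)                  ∎
    where
    open ≤-Reasoning
    h = k + m
    x = 4 * k ∸ h
    y = 4 * m ∸ h
    identity₁ : ∀ h z → 3 * (h * h) + z ≡ h * h + h * (h + h) + z
    identity₁ = solve-∀
    identity₂ : ∀ h x y → h * h + h * (x + y) + x * y ≡ (h + x) * (h + y)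
    identity₂ = solve-∀
    identity₃ : ∀ k m → 4 * k * (4 * m) ≡ 16 * (k * m)
    identity₃ = solve-∀
    x+y≡h+h : x + y ≡ h + h
    x+y≡h+h = +-cancelˡ-≡ (h + h) _ _ (begin-equality
      h + h + (x + y)        ≡⟨ identity₄ h x y ⟩
      h + x + (h + y)        ≡⟨ cong₂ _+_ (m+[n∸m]≡n (<⇒≤ h<4k)) (m+[n∸m]≡n (<⇒≤ h<4m)) ⟩
      4 * k + 4 * m          ≡⟨ identity₅ k m ⟩
      h + h + (h + h)        ∎)
      where
      identity₄ : ∀ h x y → h + h + (x + y) ≡ h + x + (h + y)
      identity₄ = solve-∀
      identity₅ : ∀ k m → 4 * k + 4 * m ≡ k + m + (k + m) + (k + m + (k + m))
      identity₅ = solve-∀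

  cut-tradeoff-arith : ∀ cS sS cT sT {H km} → cS + sS ≡ H → cT + sT ≡ H → 2 * km ≤ sS + sT →
    3 * H < 16 * km → 7 * H < 8 * cS → 4 * cT < 3 * H
  cut-tradeoff-arith cS sS cT sT {H} {km} eS eT 2km≤s 3H<16km 7H<8cS =
    *-cancelˡ-≤ 2 (+-cancelʳ-≤ (10 * H) _ _ (begin
      2 * suc (4 * cT) + 10 * H          ≡⟨ identity₁ cT H ⟩
      8 * cT + suc (7 * H) + suc (3 * H) ≤⟨ +-mono-≤ (+-monoʳ-≤ (8 * cT) 7H<8cS) 3H<16km ⟩
      8 * cT + 8 * cS + 16 * km          ≡⟨ cong (8 * cT + 8 * cS +_) (*-assoc 8 2 km) ⟩
      8 * cT + 8 * cS + 8 * (2 * km)     ≤⟨ +-monoʳ-≤ (8 * cT + 8 * cS) (*-monoʳ-≤ 8 2km≤s) ⟩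
      8 * cT + 8 * cS + 8 * (sS + sT)    ≡⟨ identity₂ cS sS cT sT ⟩
      8 * (cS + sS) + 8 * (cT + sT)      ≡⟨ cong₂ (λ a b → 8 * a + 8 * b) eS eT ⟩
      8 * H + 8 * H                      ≡⟨ identity₃ H ⟩
      2 * (3 * H) + 10 * H               ∎))
    where
    open ≤-Reasoning
    identity₁ : ∀ c H → 2 * suc (4 * c) + 10 * H ≡ 8 * c + suc (7 * H) + suc (3 * H)
    identity₁ = solve-∀
    identity₂ : ∀ cS sS cT sT → 8 * cT + 8 * cS + 8 * (sS + sT) ≡ 8 * (cS + sS) + 8 * (cT + sT)
    identity₂ = solve-∀
    identity₃ : ∀ H → 8 * H + 8 * H ≡ 2 * (3 * H) + 10 * H
    identity₃ = solve-∀

  cross-tradeoff : ∀ {h k m} A B C E → size A ≡ k → size B ≡ m → size C ≡ m → size E ≡ k →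
    k + m ≡ h → h < 4 * k → h < 4 * m →
    7 * (h * h) < 8 * cross (A ⊕ B) (C ⊕ E) → 4 * cross (A ⊕ C) (B ⊕ E) < 3 * (h * h)
  cross-tradeoff {k = k} {m} A B C E eA eB eC eE refl h<4k h<4m =
    cut-tradeoff-arith (cross (A ⊕ B) (C ⊕ E)) (same (A ⊕ B) (C ⊕ E))
                       (cross (A ⊕ C) (B ⊕ E)) (same (A ⊕ C) (B ⊕ E)) {km = k * m}
      (cross+same≡h² A B C E eA eB eC eE) (cross+same≡h² A C B E eA eC eB eE)
      (same-bound A B C E eA eB eC eE) (3h²<16km {k} {m} h<4k h<4m)
    where
    cross+same≡h² : ∀ P Q U V → size P ≡ k → size Q ≡ m → size U ≡ m → size V ≡ k →
      cross (P ⊕ Q) (U ⊕ V) + same (P ⊕ Q) (U ⊕ V) ≡ (k + m) * (k + m)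
    cross+same≡h² P Q U V eP eQ eU eV = trans (cross+same≡size*size (P ⊕ Q) (U ⊕ V))
      (cong₂ _*_ (trans (size-⊕ P Q) (cong₂ _+_ eP eQ))
                 (trans (size-⊕ U V) (trans (cong₂ _+_ eU eV) (+-comm m k))))

  split : ∀ {n} → Subset n → Subset n → Split
  split R X = mkSplit ∣ R ∩ X ∣ ∣ ∁ R ∩ X ∣

  cut : ∀ {n} → Subset n → Subset n → ℕ
  cut R S = cross (split R S) (split R (∁ S))

  ∣p∩q∣+∣∁p∩q∣≡∣q∣ : ∀ {n} (p q : Subset n) → ∣ p ∩ q ∣ + ∣ ∁ p ∩ q ∣ ≡ ∣ q ∣
  ∣p∩q∣+∣∁p∩q∣≡∣q∣ []          []          = refl
  ∣p∩q∣+∣∁p∩q∣≡∣q∣ (true  ∷ p) (true  ∷ q) = cong suc (∣p∩q∣+∣∁p∩q∣≡∣q∣ p q)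
  ∣p∩q∣+∣∁p∩q∣≡∣q∣ (false ∷ p) (true  ∷ q) = trans (+-suc _ _) (cong suc (∣p∩q∣+∣∁p∩q∣≡∣q∣ p q))
  ∣p∩q∣+∣∁p∩q∣≡∣q∣ (true  ∷ p) (false ∷ q) = ∣p∩q∣+∣∁p∩q∣≡∣q∣ p q
  ∣p∩q∣+∣∁p∩q∣≡∣q∣ (false ∷ p) (false ∷ q) = ∣p∩q∣+∣∁p∩q∣≡∣q∣ p q

  ∣p∩q∣≡∣p∩[q∩r]∣+∣p∩[q∩∁r]∣ : ∀ {n} (p q r : Subset n) → ∣ p ∩ q ∣ ≡ ∣ p ∩ (q ∩ r) ∣ + ∣ p ∩ (q ∩ ∁ r) ∣
  ∣p∩q∣≡∣p∩[q∩r]∣+∣p∩[q∩∁r]∣ []          []          []          = refl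
  ∣p∩q∣≡∣p∩[q∩r]∣+∣p∩[q∩∁r]∣ (false ∷ p) (_     ∷ q) (_     ∷ r) = ∣p∩q∣≡∣p∩[q∩r]∣+∣p∩[q∩∁r]∣ p q r
  ∣p∩q∣≡∣p∩[q∩r]∣+∣p∩[q∩∁r]∣ (true  ∷ p) (false ∷ q) (_     ∷ r) = ∣p∩q∣≡∣p∩[q∩r]∣+∣p∩[q∩∁r]∣ p q r
  ∣p∩q∣≡∣p∩[q∩r]∣+∣p∩[q∩∁r]∣ (true  ∷ p) (true  ∷ q) (true  ∷ r) =
    cong suc (∣p∩q∣≡∣p∩[q∩r]∣+∣p∩[q∩∁r]∣ p q r)
  ∣p∩q∣≡∣p∩[q∩r]∣+∣p∩[q∩∁r]∣ (true  ∷ p) (true  ∷ q) (false ∷ r) =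
    trans (cong suc (∣p∩q∣≡∣p∩[q∩r]∣+∣p∩[q∩∁r]∣ p q r)) (sym (+-suc _ _))

  size-split : ∀ {n} (R X : Subset n) → size (split R X) ≡ ∣ X ∣
  size-split = ∣p∩q∣+∣∁p∩q∣≡∣q∣

  split-∩ˡ : ∀ {n} (R X Y : Subset n) → split R X ≡ split R (X ∩ Y) ⊕ split R (X ∩ ∁ Y)
  split-∩ˡ R X Y =
    cong₂ mkSplit (∣p∩q∣≡∣p∩[q∩r]∣+∣p∩[q∩∁r]∣ R X Y) (∣p∩q∣≡∣p∩[q∩r]∣+∣p∩[q∩∁r]∣ (∁ R) X Y)

  split-∩ʳ : ∀ {n} (R X Y : Subset n) → split R Y ≡ split R (X ∩ Y) ⊕ split R (∁ X ∩ Y)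
  split-∩ʳ R X Y = begin
    split R Y                            ≡⟨ split-∩ˡ R Y X ⟩
    split R (Y ∩ X) ⊕ split R (Y ∩ ∁ X)  ≡⟨ cong₂ (λ U V → split R U ⊕ split R V) (∩-comm Y X) (∩-comm Y (∁ X)) ⟩
    split R (X ∩ Y) ⊕ split R (∁ X ∩ Y)  ∎
    where open ≡-Reasoning

  4k<3h⇒h<4m : ∀ {h k m} → k + m ≡ h → 4 * k < 3 * h → h < 4 * m
  4k<3h⇒h<4m {k = k} {m} refl 4k<3h = +-cancelˡ-< (4 * k) _ _ (begin-strict
    4 * k + (k + m)        <⟨ +-monoˡ-< (k + m) 4k<3h ⟩
    3 * (k + m) + (k + m)  ≡⟨ identity k m ⟩
    4 * k + 4 * m          ∎)
    where
    open ≤-Reasoning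
    identity : ∀ k m → 3 * (k + m) + (k + m) ≡ 4 * k + 4 * m
    identity = solve-∀

  cut-tradeoff-h : ∀ {n h} (R S T : Subset n) → n ≡ h + h → ∣ S ∣ ≡ h → ∣ T ∣ ≡ h →
    h < 4 * ∣ S ∩ T ∣ → 4 * ∣ S ∩ T ∣ < 3 * h →
    7 * (h * h) < 8 * cut R S → 4 * cut R T < 3 * (h * h)
  cut-tradeoff-h {h = h} R S T refl ∣S∣≡h ∣T∣≡h h<4k 4k<3h 7h²<8cutS =
    subst (λ c → 4 * c < 3 * (h * h)) (sym cutT≡)
      (cross-tradeoff {k = ∣ S ∩ T ∣} A B C E (size-split R (S ∩ T)) refl size-C size-E k+m≡h
        h<4k (4k<3h⇒h<4m {k = ∣ S ∩ T ∣} k+m≡h 4k<3h)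
        (subst (λ c → 7 * (h * h) < 8 * c) cutS≡ 7h²<8cutS))
    where
    A = split R (S ∩ T)
    B = split R (S ∩ ∁ T)
    C = split R (∁ S ∩ T)
    E = split R (∁ S ∩ ∁ T)
    S≡A⊕B = split-∩ˡ R S T
    ∁S≡C⊕E = split-∩ˡ R (∁ S) T
    T≡A⊕C = split-∩ʳ R S T
    ∁T≡B⊕E = split-∩ʳ R S (∁ T)
    cutS≡ : cut R S ≡ cross (A ⊕ B) (C ⊕ E)
    cutS≡ = cong₂ cross S≡A⊕B ∁S≡C⊕E
    cutT≡ : cut R T ≡ cross (A ⊕ C) (B ⊕ E)
    cutT≡ = cong₂ cross T≡A⊕C ∁T≡B⊕E
    size-parts : ∀ P Q X → split R X ≡ P ⊕ Q → size P + size Q ≡ ∣ X ∣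
    size-parts P Q X X≡P⊕Q = trans (sym (size-⊕ P Q)) (trans (cong size (sym X≡P⊕Q)) (size-split R X))
    ∣∁S∣≡h : ∣ ∁ S ∣ ≡ h
    ∣∁S∣≡h = trans (∣∁p∣≡n∸∣p∣ S) (trans (cong (h + h ∸_) ∣S∣≡h) (m+n∸n≡m h h))
    A+B≡h : size A + size B ≡ h
    A+B≡h = trans (size-parts A B S S≡A⊕B) ∣S∣≡h
    A+C≡h : size A + size C ≡ h
    A+C≡h = trans (size-parts A C T T≡A⊕C) ∣T∣≡h
    C+E≡h : size C + size E ≡ h
    C+E≡h = trans (size-parts C E (∁ S) ∁S≡C⊕E) ∣∁S∣≡h
    k+m≡h : ∣ S ∩ T ∣ + size B ≡ h
    k+m≡h = trans (cong (_+ size B) (sym (size-split R (S ∩ T)))) A+B≡h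
    size-C : size C ≡ size B
    size-C = +-cancelˡ-≡ (size A) _ _ (trans A+C≡h (sym A+B≡h))
    size-E : size E ≡ ∣ S ∩ T ∣
    size-E = trans (+-cancelˡ-≡ (size C) _ _ (trans C+E≡h (trans (sym A+C≡h) (+-comm (size A) (size C)))))
      (size-split R (S ∩ T))

  𝟙 : Bool → ℕ
  𝟙 true  = 1
  𝟙 false = 0

  ∣p∣≡∑𝟙 : ∀ {n} (p : Subset n) → ∣ p ∣ ≡ ∑[ i < n ] 𝟙 (lookup p i)
  ∣p∣≡∑𝟙 []          = refl
  ∣p∣≡∑𝟙 (true  ∷ p) = cong suc (∣p∣≡∑𝟙 p)
  ∣p∣≡∑𝟙 (false ∷ p) = ∣p∣≡∑𝟙 p

  ∣p∩q∣≡∑𝟙 : ∀ {n} (p q : Subset n) → ∣ p ∩ q ∣ ≡ ∑[ i < n ] 𝟙 (lookup p i ∧ lookup q i)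
  ∣p∩q∣≡∑𝟙 p q = trans (∣p∣≡∑𝟙 (p ∩ q)) (sum-cong-≗ (λ i → cong 𝟙 (lookup-zipWith _∧_ i p q)))

  ∑∑-* : ∀ {m n} (f : Fin m → ℕ) (g : Fin n → ℕ) → ∑[ i < m ] ∑[ j < n ] (f i * g j) ≡ sum f * sum g
  ∑∑-* f g = sym (trans (*-distribʳ-sum (sum g) f) (sum-cong-≗ (λ i → *-distribˡ-sum (f i) g)))

  cut≡∑∑ : ∀ {n} (R S : Subset n) → cut R S ≡
    ∑[ i < n ] ∑[ j < n ] (𝟙 (lookup R i ∧ lookup S i) * 𝟙 (lookup (∁ R) j ∧ lookup (∁ S) j)
                         + 𝟙 (lookup R i ∧ lookup (∁ S) i) * 𝟙 (lookup (∁ R) j ∧ lookup S j))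
  cut≡∑∑ {n} R S = begin
    cut R S
      ≡⟨ cong₂ _+_ (cong₂ _*_ (∣p∩q∣≡∑𝟙 R S) (∣p∩q∣≡∑𝟙 (∁ R) (∁ S)))
                   (cong₂ _*_ (∣p∩q∣≡∑𝟙 R (∁ S)) (∣p∩q∣≡∑𝟙 (∁ R) S)) ⟩
    sum f * sum g + sum f′ * sum g′
      ≡⟨ cong₂ _+_ (∑∑-* f g) (∑∑-* f′ g′) ⟨
    ∑[ i < n ] ∑[ j < n ] (f i * g j) + ∑[ i < n ] ∑[ j < n ] (f′ i * g′ j)
      ≡⟨ ∑-distrib-+ (λ i → ∑[ j < n ] (f i * g j)) (λ i → ∑[ j < n ] (f′ i * g′ j)) ⟨
    ∑[ i < n ] (∑[ j < n ] (f i * g j) + ∑[ j < n ] (f′ i * g′ j))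
      ≡⟨ sum-cong-≗ (λ i → ∑-distrib-+ (λ j → f i * g j) (λ j → f′ i * g′ j)) ⟨
    ∑[ i < n ] ∑[ j < n ] (f i * g j + f′ i * g′ j) ∎
    where
    open ≡-Reasoning
    f g f′ g′ : Fin n → ℕ
    f  i = 𝟙 (lookup R i ∧ lookup S i)
    g  j = 𝟙 (lookup (∁ R) j ∧ lookup (∁ S) j)
    f′ i = 𝟙 (lookup R i ∧ lookup (∁ S) i)
    g′ j = 𝟙 (lookup (∁ R) j ∧ lookup S j)

  cut-tradeoff : ∀ {n h} (R S T : Subset n) → n ≡ h + h → ∣ S ∣ ≡ h → ∣ T ∣ ≡ h →
    n < ∣ S ∩ T ∣ * 8 → ∣ S ∩ T ∣ * 8 < 3 * n →
    7 * n * n < 2 * cut R S * 16 → 2 * cut R T * 16 ≤ 6 * n * n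
  cut-tradeoff {h = h} R S T refl ∣S∣≡h ∣T∣≡h n<8k 8k<3n 7n²<32cutS =
    subst₂ _≤_ (identity₆ (cut R T)) (identity₇ h) (*-monoʳ-≤ 8 (<⇒≤
      (cut-tradeoff-h R S T refl ∣S∣≡h ∣T∣≡h h<4k 4k<3h 7h²<8cutS)))
    where
    k = ∣ S ∩ T ∣
    identity₁ : ∀ h → h + h ≡ 2 * h
    identity₁ = solve-∀
    identity₂ : ∀ k → k * 8 ≡ 2 * (4 * k)
    identity₂ = solve-∀
    identity₃ : ∀ h → 3 * (h + h) ≡ 2 * (3 * h)
    identity₃ = solve-∀
    identity₄ : ∀ h → 7 * (h + h) * (h + h) ≡ 4 * (7 * (h * h))
    identity₄ = solve-∀
    identity₅ : ∀ c → 2 * c * 16 ≡ 4 * (8 * c)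
    identity₅ = solve-∀
    identity₆ : ∀ c → 8 * (4 * c) ≡ 2 * c * 16
    identity₆ = solve-∀
    identity₇ : ∀ h → 8 * (3 * (h * h)) ≡ 6 * (h + h) * (h + h)
    identity₇ = solve-∀
    h<4k : h < 4 * k
    h<4k = *-cancelˡ-< 2 h (4 * k) (subst₂ _<_ (identity₁ h) (identity₂ k) n<8k)
    4k<3h : 4 * k < 3 * h
    4k<3h = *-cancelˡ-< 2 (4 * k) (3 * h) (subst₂ _<_ (identity₂ k) (identity₃ h) 8k<3n)
    7h²<8cutS : 7 * (h * h) < 8 * cut R S
    7h²<8cutS = *-cancelˡ-< 4 _ _ (subst₂ _<_ (identity₄ h) (identity₅ (cut R S)) 7n²<32cutS)

open import Defs
open import Data.Nat using (ℕ; NonZero)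
open import Data.Integer using (+_)
open import Data.Rational using (ℚ; 0ℚ; _*_; _/_; _<_; _≤_)
open import Data.Fin.Subset using (Subset; ∣_∣; _∩_)
open import Relation.Binary.PropositionalEquality using (_≡_; _≢_)

open import Data.Nat as ℕ using (zero; suc)
import Data.Nat.Properties as ℕ
import Data.Integer as ℤ
import Data.Integer.Properties as ℤ
open import Data.Rational using (_+_; toℚᵘ; nonNegative)
open import Data.Rational.Properties
  using (toℚᵘ-injective; toℚᵘ-fromℚᵘ; toℚᵘ-homo-+; toℚᵘ-homo-*; toℚᵘ-mono-<; toℚᵘ-cancel-≤;
         *-zeroʳ; *-identityʳ; *-distribˡ-+; *-assoc; *-comm; <⇒≤; *-cancelʳ-<-nonNeg; *-monoʳ-≤-nonNeg)
open import Data.Rational.Unnormalised as ℚᵘ using (mkℚᵘ; *≡*; *≤*) renaming (_≃_ to _≃ᵘ_; _/_ to _/ᵘ_)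
import Data.Rational.Unnormalised.Properties as ℚᵘ
open import Data.Bool.Base using (true; false; if_then_else_; _∧_; not; _xor_)
open import Data.Fin.Base using (Fin; zero; suc)
open import Data.Vec.Base using (lookup)
open import Data.Vec.Properties using (lookup-map)
open import Data.Fin.Subset using (∁)
open import Relation.Binary.PropositionalEquality
  using (refl; sym; trans; cong; cong₂; subst; subst₂; module ≡-Reasoning)

open Counting using (𝟙; cut; cut≡∑∑; cut-tradeoff)
open import Algebra.Properties.Semiring.Sum ℕ.+-*-semiring using (sum)

ι : ℕ → ℚ
ι k = + k / 1

toℚᵘ-/ : ∀ a q .{{_ : NonZero q}} → toℚᵘ (+ a / q) ≃ᵘ + a /ᵘ q
toℚᵘ-/ a (suc q) = toℚᵘ-fromℚᵘ (mkℚᵘ (+ a) q)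

ι-+ : ∀ a b → ι (a ℕ.+ b) ≡ ι a + ι b
ι-+ a b = toℚᵘ-injective (begin
  toℚᵘ (ι (a ℕ.+ b))           ≈⟨ toℚᵘ-/ (a ℕ.+ b) 1 ⟩
  + (a ℕ.+ b) /ᵘ 1             ≈⟨ *≡* (cong (ℤ._* + 1) (trans (ℤ.pos-+ a b)
                                    (sym (cong₂ ℤ._+_ (ℤ.*-identityʳ (+ a)) (ℤ.*-identityʳ (+ b)))))) ⟩
  (+ a /ᵘ 1) ℚᵘ.+ (+ b /ᵘ 1)   ≈⟨ ℚᵘ.+-cong (toℚᵘ-/ a 1) (toℚᵘ-/ b 1) ⟨
  toℚᵘ (ι a) ℚᵘ.+ toℚᵘ (ι b)   ≈⟨ toℚᵘ-homo-+ (ι a) (ι b) ⟨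
  toℚᵘ (ι a + ι b)             ∎)
  where open ℚᵘ.≃-Reasoning

/-*-ι : ∀ a q b .{{_ : NonZero q}} → (+ a / q) * ι b ≡ + (a ℕ.* b) / q
/-*-ι a q@(suc _) b = toℚᵘ-injective (begin
  toℚᵘ ((+ a / q) * ι b)           ≈⟨ toℚᵘ-homo-* (+ a / q) (ι b) ⟩
  toℚᵘ (+ a / q) ℚᵘ.* toℚᵘ (ι b)   ≈⟨ ℚᵘ.*-cong (toℚᵘ-/ a q) (toℚᵘ-/ b 1) ⟩
  (+ a /ᵘ q) ℚᵘ.* (+ b /ᵘ 1)       ≈⟨ *≡* (cong₂ ℤ._*_ (sym (ℤ.pos-* a b)) (cong +_ (sym (ℕ.*-identityʳ q)))) ⟩
  + (a ℕ.* b) /ᵘ q                 ≈⟨ toℚᵘ-/ (a ℕ.* b) q ⟨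
  toℚᵘ (+ (a ℕ.* b) / q)           ∎)
  where open ℚᵘ.≃-Reasoning

/<⇒*< : ∀ a b {q r} .{{_ : NonZero q}} .{{_ : NonZero r}} →
  + a / q < + b / r → a ℕ.* r ℕ.< b ℕ.* q
/<⇒*< a b {q@(suc _)} {r@(suc _)} lt = ℤ.drop‿+<+ (subst₂ ℤ._<_ (sym (ℤ.pos-* a r)) (sym (ℤ.pos-* b q))
  (ℚᵘ.drop-*<* (ℚᵘ.<-respˡ-≃ (toℚᵘ-/ a q) (ℚᵘ.<-respʳ-≃ (toℚᵘ-/ b r) (toℚᵘ-mono-< lt)))))

*≤⇒/≤ : ∀ a b {q r} .{{_ : NonZero q}} .{{_ : NonZero r}} →
  a ℕ.* r ℕ.≤ b ℕ.* q → + a / q ≤ + b / r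
*≤⇒/≤ a b {q@(suc _)} {r@(suc _)} le = toℚᵘ-cancel-≤
  (ℚᵘ.≤-respˡ-≃ (ℚᵘ.≃-sym (toℚᵘ-/ a q)) (ℚᵘ.≤-respʳ-≃ (ℚᵘ.≃-sym (toℚᵘ-/ b r))
    (*≤* (subst₂ ℤ._≤_ (ℤ.pos-* a r) (ℤ.pos-* b q) (ℤ.+≤+ le)))))

sumFin-cong : ∀ {n} {f g : Fin n → ℚ} → (∀ i → f i ≡ g i) → sumFin f ≡ sumFin g
sumFin-cong {zero}  f≗g = refl
sumFin-cong {suc n} f≗g = cong₂ _+_ (f≗g zero) (sumFin-cong (λ i → f≗g (suc i)))

sumFin-*ι : ∀ {n} (c : ℚ) (f : Fin n → ℕ) → sumFin (λ i → c * ι (f i)) ≡ c * ι (sum f)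
sumFin-*ι {zero}  c f = sym (*-zeroʳ c)
sumFin-*ι {suc n} c f = begin
  c * ι (f zero) + sumFin (λ i → c * ι (f (suc i)))
    ≡⟨ cong (λ x → c * ι (f zero) + x) (sumFin-*ι c (λ i → f (suc i))) ⟩
  c * ι (f zero) + c * ι (sum (λ i → f (suc i)))     ≡⟨ *-distribˡ-+ c _ _ ⟨
  c * (ι (f zero) + ι (sum (λ i → f (suc i))))       ≡⟨ cong (c *_) (ι-+ (f zero) _) ⟨
  c * ι (sum f)                                      ∎
  where open ≡-Reasoning

Φ-summand : ∀ (c : ℚ) r r′ s s′ →
  (if r then (if r′ then 0ℚ else (if s xor s′ then c else 0ℚ)) else 0ℚ)
    ≡ c * ι (𝟙 (r ∧ s) ℕ.* 𝟙 (not r′ ∧ not s′) ℕ.+ 𝟙 (r ∧ not s) ℕ.* 𝟙 (not r′ ∧ s′))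
Φ-summand c false _     _     _     = sym (*-zeroʳ c)
Φ-summand c true  true  true  _     = sym (*-zeroʳ c)
Φ-summand c true  true  false _     = sym (*-zeroʳ c)
Φ-summand c true  false true  true  = sym (*-zeroʳ c)
Φ-summand c true  false true  false = sym (*-identityʳ c)
Φ-summand c true  false false true  = sym (*-identityʳ c)
Φ-summand c true  false false false = sym (*-zeroʳ c)

Φ-G : ∀ n .{{_ : NonZero n}} d (S R : Subset n) → Φ (G n d S) R ≡ (+ (2 ℕ.* cut R S) / n) * d
Φ-G n d S R = begin
  Φ (G n d S) R
    ≡⟨ sumFin-cong (λ i → sumFin-cong (λ j → summand i j)) ⟩
  sumFin (λ i → sumFin (λ j → c * ι (pairs i j)))
    ≡⟨ sumFin-cong (λ i → sumFin-*ι c (pairs i)) ⟩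
  sumFin (λ i → c * ι (sum (pairs i)))
    ≡⟨ sumFin-*ι c (λ i → sum (pairs i)) ⟩
  c * ι (sum (λ i → sum (pairs i)))
    ≡⟨ cong (λ x → c * ι x) (cut≡∑∑ R S) ⟨
  ((+ 2 / n) * d) * ι (cut R S)
    ≡⟨ trans (*-assoc (+ 2 / n) d _)
             (trans (cong ((+ 2 / n) *_) (*-comm d _)) (sym (*-assoc (+ 2 / n) _ d))) ⟩
  ((+ 2 / n) * ι (cut R S)) * d
    ≡⟨ cong (_* d) (/-*-ι 2 n (cut R S)) ⟩
  (+ (2 ℕ.* cut R S) / n) * d ∎
  where
  open ≡-Reasoning
  c = (+ 2 / n) * d
  pairs : Fin n → Fin n → ℕ
  pairs i j = 𝟙 (lookup R i ∧ lookup S i) ℕ.* 𝟙 (lookup (∁ R) j ∧ lookup (∁ S) j)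
        ℕ.+ 𝟙 (lookup R i ∧ lookup (∁ S) i) ℕ.* 𝟙 (lookup (∁ R) j ∧ lookup S j)
  lookup-∁ : ∀ (p : Subset n) i → lookup (∁ p) i ≡ not (lookup p i)
  lookup-∁ p i = lookup-map i not p
  summand : ∀ i j →
    (if lookup R i then (if lookup R j then 0ℚ else G n d S i j) else 0ℚ) ≡ c * ι (pairs i j)
  summand i j rewrite lookup-∁ R j | lookup-∁ S i | lookup-∁ S j =
    Φ-summand c (lookup R i) (lookup R j) (lookup S i) (lookup S j)

/<ι⇒<* : ∀ a b {q} .{{_ : NonZero q}} → + a / q < ι b → a ℕ.< b ℕ.* q
/<ι⇒<* a b lt = subst (ℕ._< _) (ℕ.*-identityʳ a) (/<⇒*< a b lt)

ι</⇒*< : ∀ a b {r} .{{_ : NonZero r}} → ι a < + b / r → a ℕ.* r ℕ.< b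
ι</⇒*< a b lt = subst (_ ℕ.<_) (ℕ.*-identityʳ b) (/<⇒*< a b lt)

Φ-G>⇒cut> : ∀ n .{{_ : NonZero n}} a {q} .{{_ : NonZero q}} d → 0ℚ ≤ d → (S R : Subset n) →
  (+ a / q) * d < Φ (G n d S) R → a ℕ.* n ℕ.< 2 ℕ.* cut R S ℕ.* q
Φ-G>⇒cut> n a d 0≤d S R lt = /<⇒*< a (2 ℕ.* cut R S)
  (*-cancelʳ-<-nonNeg d {{nonNegative 0≤d}} (subst (_ <_) (Φ-G n d S R) lt))

cut≤⇒Φ-G≤ : ∀ n .{{_ : NonZero n}} a {q} .{{_ : NonZero q}} d → 0ℚ ≤ d → (S R : Subset n) →
  2 ℕ.* cut R S ℕ.* q ℕ.≤ a ℕ.* n → Φ (G n d S) R ≤ (+ a / q) * d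
cut≤⇒Φ-G≤ n a d 0≤d S R le = subst (_≤ _) (sym (Φ-G n d S R))
  (*-monoʳ-≤-nonNeg d {{nonNegative 0≤d}} (*≤⇒/≤ (2 ℕ.* cut R S) a le))

lemma6p11 : (n h : ℕ) → .{{_ : NonZero n}} → n ≡ h Data.Nat.+ h →
    (d : ℚ) → 0ℚ < d →
    (S T : Subset n) → ∣ S ∣ ≡ h → ∣ T ∣ ≡ h → S ≢ T →
    (+ n / 8) < (+ ∣ S ∩ T ∣ / 1) → (+ ∣ S ∩ T ∣ / 1) < (+ (3 Data.Nat.* n) / 8) →
    (R : Subset n) →
    ((+ (7 Data.Nat.* n) / 16) * d) < Φ (G n d S) R →
    Φ (G n d T) R ≤ ((+ (6 Data.Nat.* n) / 16) * d)
lemma6p11 n h n≡h+h d 0<d S T ∣S∣≡h ∣T∣≡h _ n/8<k k<3n/8 R Φ-S-large =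
  cut≤⇒Φ-G≤ n (6 ℕ.* n) d (<⇒≤ 0<d) T R
    (cut-tradeoff R S T n≡h+h ∣S∣≡h ∣T∣≡h
      (/<ι⇒<* n ∣ S ∩ T ∣ n/8<k) (ι</⇒*< ∣ S ∩ T ∣ (3 ℕ.* n) k<3n/8)
      (Φ-G>⇒cut> n (7 ℕ.* n) d (<⇒≤ 0<d) S R Φ-S-large))
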